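{- Let $x_1>0$ and let $\mathcal{A}_1,\mathcal{A}_2,\dots$ be an infinite sequence of finite nonempty sets of nonnegative integers, with $M_n=\max\mathcal{A}_n$. Define $x_n$ for $n\ge2$ by $x_n=x_1+M_n^2+M_n(x_{n-1}+M_{n-1})+(x_{n-1}+M_{n-1})^2$, and let $\mathcal{A}=\bigcup_{n\ge1}(x_n+\mathcal{A}_n)$. Then every nonzero difference $d=c_1c_2-c_3c_4$ with $c_1,c_2,c_3,c_4\in\mathcal{A}$, such that the $c_i$ do not all belong to the same set $x_n+\mathcal{A}_n$, satisfies $|d|\ge x_1$.
   Context: $x_n+\mathcal{A}_n$ denotes the translate $\{x_n+a: a\in\mathcal{A}_n\}$. -}

module Defs where

open import Data.Nat using (ℕ; zero; suc; _+_; _*_; _⊔_)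
open import Data.List using (List; _∷_; foldr)
open import Data.List.Membership.Propositional using (_∈_)
open import Data.Product using (∃; _×_)
open import Relation.Binary.PropositionalEquality using (_≡_)

-- A finite nonempty set of nonnegative integers, given as a nonempty list
-- (head ∷ tail); duplicates are harmless.
record NEFinSet : Set where
  constructor mk
  field
    hd : ℕ
    tl : List ℕ

open NEFinSet public

elems : NEFinSet → List ℕ
elems S = hd S ∷ tl S

maxS : NEFinSet → ℕ
maxS S = foldr _⊔_ (hd S) (tl S)

-- Sequences are indexed from 0: index k stands for the paper's index k+1.
-- xs x₁ A k = x_{k+1}
xs : ℕ → (ℕ → NEFinSet) → ℕ → ℕ
xs x₁ A zero = x₁
xs x₁ A (suc k) =
  let y = xs x₁ A k + maxS (A k)
      M = maxS (A (suc k))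
  in x₁ + M * M + M * y + y * y

InTranslate : ℕ → (ℕ → NEFinSet) → ℕ → ℕ → Set
InTranslate x₁ A k c = ∃ λ a → a ∈ elems (A k) × c ≡ xs x₁ A k + a

InUnion : ℕ → (ℕ → NEFinSet) → ℕ → Set
InUnion x₁ A c = ∃ λ k → InTranslate x₁ A k c

module Submission where

-- Let n be the largest block index among c₁,…,c₄.  Every
-- element of block n lies in [x, x + M] with x = x_n, M = M_n ("high"),
-- while every element of an earlier block lies in [x₁, y] with y the
-- largest element of the blocks before n ("low").  The recursion for x_n
-- gives the spacing conditions  x₁ + M·y ≤ x  and  x₁ + y² ≤ x.  A product
-- of two factors is then of one of three shapes: high·high (≥ x²),
-- high·low (in [x, (x+M)·y]) or low·low (≤ y²), and the spacing conditions
-- put any two products of different shapes at least x₁ apart.  Two products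
-- of the same shape are high·high or low·low only if all four factors are
-- high (excluded: not all in one block) or all low (excluded: n is
-- attained); two distinct high·low products are at least x₁ apart by
-- comparing their low factors, and their high factors when the low ones agree.

open import Defs
open import Data.Bool using (Bool; true; false; T; _∧_; _∨_)
open import Data.Bool.Properties using (T-∧; T-∨)
open import Data.Empty using (⊥-elim)
open import Data.Integer using (+_; _-_; ∣_∣)
import Data.Integer.Properties as ℤ
open import Data.List.Membership.Propositional using (_∈_)
open import Data.List.Properties using (foldr-preservesᵒ)
open import Data.List.Relation.Unary.Any as Any using (here; there)
open import Data.Nat using (ℕ; zero; suc; _+_; _*_; _∸_; _⊔_; _≤_; _<_; _>_; _≟_; z≤n; s≤s)
open import Data.Nat.Properties
open import Data.Product using (∃; _×_; _,_)
open import Data.Sum using (_⊎_; inj₁; inj₂; [_,_])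
open import Data.Unit using (tt)
open import Function using (Equivalence)
open import Relation.Binary using (tri<; tri≈; tri>)
open import Relation.Binary.PropositionalEquality
  using (_≡_; _≢_; refl; sym; trans; cong; subst)
open import Relation.Nullary using (¬_; yes; no)
open import Relation.Nullary.Decidable using (⌊_⌋; toWitness; fromWitness)

Apart : ℕ → ℕ → ℕ → Set
Apart a p q = a + q ≤ p ⊎ a + p ≤ q

gap⇒distance : ∀ {a p q} → a + q ≤ p → a ≤ ∣ + p - + q ∣
gap⇒distance {a} {p} {q} a+q≤p
  rewrite ℤ.m-n≡m⊖n p q | ℤ.⊖-≥ (≤-trans (m≤n+m q a) a+q≤p) =
  subst (_≤ p ∸ q) (m+n∸n≡m a q) (∸-monoˡ-≤ q a+q≤p)

apart⇒distance : ∀ {a p q} → Apart a p q → a ≤ ∣ + p - + q ∣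
apart⇒distance (inj₁ a+q≤p) = gap⇒distance a+q≤p
apart⇒distance {a} {p} {q} (inj₂ a+p≤q)
  rewrite ℤ.m-n≡m⊖n p q | ℤ.∣m⊖n∣≡∣n⊖m∣ p q | sym (ℤ.m-n≡m⊖n q p) =
  gap⇒distance a+p≤q

difference≢0 : ∀ p q → + p - + q ≢ + 0 → p ≢ q
difference≢0 p .p p-p≢0 refl = p-p≢0 (trans (ℤ.m-n≡m⊖n p p) (ℤ.n⊖n≡0 p))

n≤n*n : ∀ n → n ≤ n * n
n≤n*n zero    = z≤n
n≤n*n (suc n) = m≤m*n (suc n) (suc n)

-- The spacing conditions between a block starting at x with spread M and
-- the elements of all earlier blocks, which lie in [x₁, y].
record Spacing (x₁ x M y : ℕ) : Set where
  field
    x₁-pos     : 0 < x₁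
    linear-gap : x₁ + M * y ≤ x
    square-gap : x₁ + y * y ≤ x

module SpacedBlocks {x₁ x M y : ℕ} (spacing : Spacing x₁ x M y) where
  open Spacing spacing
  open ≤-Reasoning

  -- Earlier elements lie below the block: y < 1 + y² ≤ x₁ + y² ≤ x.
  y<x : y < x
  y<x = ≤-trans (+-mono-≤ x₁-pos (n≤n*n y)) square-gap

  -- An element of the current block (true) or of an earlier block (false).
  data Size : Bool → ℕ → Set where
    high : ∀ {c} → x ≤ c → c ≤ x + M → Size true c
    low  : ∀ {c} → x₁ ≤ c → c ≤ y → Size false c

  -- The shape of a product, indexed by whether both / some factor is high.
  data Shape : Bool → Bool → ℕ → Set where
    high×high : ∀ {p} → x * x ≤ p → Shape true true p
    high×low  : ∀ {h l} → Size true h → Size false l → Shape false true (h * l)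
    low×low   : ∀ {p} → p ≤ y * y → Shape false false p

  shape : ∀ {b b′ c d} → Size b c → Size b′ d → Shape (b ∧ b′) (b ∨ b′) (c * d)
  shape (high x≤c _) (high x≤d _) = high×high (*-mono-≤ x≤c x≤d)
  shape h@(high _ _) l@(low _ _)  = high×low h l
  shape {c = c} {d} l@(low _ _) h@(high _ _) =
    subst (Shape false true) (*-comm d c) (high×low h l)
  shape (low _ c≤y) (low _ d≤y)   = low×low (*-mono-≤ c≤y d≤y)

  mixed-lower : ∀ {h l} → Size true h → Size false l → x ≤ h * l
  mixed-lower {h} {l} (high x≤h _) (low x₁≤l _) = begin
    x     ≡⟨ sym (*-identityʳ x) ⟩
    x * 1 ≤⟨ *-mono-≤ x≤h (≤-trans x₁-pos x₁≤l) ⟩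
    h * l ∎

  mixed-upper : ∀ {h l} → Size true h → Size false l → h * l ≤ (x + M) * y
  mixed-upper (high _ h≤x+M) (low _ l≤y) = *-mono-≤ h≤x+M l≤y

  low×low≤mixed : y * y ≤ (x + M) * y
  low×low≤mixed = *-monoˡ-≤ y (≤-trans (<⇒≤ y<x) (m≤m+n x M))

  above-x² : ∀ {p q} → q ≤ (x + M) * y → x * x ≤ p → x₁ + q ≤ p
  above-x² {p} {q} q≤ x²≤p = begin
    x₁ + q               ≤⟨ +-monoʳ-≤ x₁ q≤ ⟩
    x₁ + (x + M) * y     ≡⟨ cong (_+_ x₁) (*-distribʳ-+ y x M) ⟩
    x₁ + (x * y + M * y) ≡⟨ +-comm x₁ (x * y + M * y) ⟩
    x * y + M * y + x₁   ≡⟨ +-assoc (x * y) (M * y) x₁ ⟩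
    x * y + (M * y + x₁) ≡⟨ cong (_+_ (x * y)) (+-comm (M * y) x₁) ⟩
    x * y + (x₁ + M * y) ≤⟨ +-monoʳ-≤ (x * y) linear-gap ⟩
    x * y + x            ≡⟨ +-comm (x * y) x ⟩
    x + x * y            ≡⟨ sym (*-suc x y) ⟩
    x * suc y            ≤⟨ *-monoʳ-≤ x y<x ⟩
    x * x                ≤⟨ x²≤p ⟩
    p                    ∎

  above-x : ∀ {p q} → q ≤ y * y → x ≤ p → x₁ + q ≤ p
  above-x q≤ x≤p = ≤-trans (+-monoʳ-≤ x₁ q≤) (≤-trans square-gap x≤p)

  -- Two high·low products: a larger low factor outweighs the spread M of
  -- the high factors.
  larger-low-factor : ∀ {h₁ l₁ h₂ l₂} → h₁ ≤ x + M → x ≤ h₂ → l₁ ≤ y → l₁ < l₂ →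
                      x₁ + h₁ * l₁ ≤ h₂ * l₂
  larger-low-factor {h₁} {l₁} {h₂} {l₂} h₁≤ x≤h₂ l₁≤y l₁<l₂ = begin
    x₁ + h₁ * l₁            ≤⟨ +-monoʳ-≤ x₁ (*-monoˡ-≤ l₁ (≤-trans h₁≤ (+-monoˡ-≤ M x≤h₂))) ⟩
    x₁ + (h₂ + M) * l₁      ≡⟨ cong (_+_ x₁) (*-distribʳ-+ l₁ h₂ M) ⟩
    x₁ + (h₂ * l₁ + M * l₁) ≡⟨ +-comm x₁ (h₂ * l₁ + M * l₁) ⟩
    h₂ * l₁ + M * l₁ + x₁   ≡⟨ +-assoc (h₂ * l₁) (M * l₁) x₁ ⟩
    h₂ * l₁ + (M * l₁ + x₁) ≡⟨ cong (_+_ (h₂ * l₁)) (+-comm (M * l₁) x₁) ⟩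
    h₂ * l₁ + (x₁ + M * l₁) ≤⟨ +-monoʳ-≤ (h₂ * l₁) (+-monoʳ-≤ x₁ (*-monoʳ-≤ M l₁≤y)) ⟩
    h₂ * l₁ + (x₁ + M * y)  ≤⟨ +-monoʳ-≤ (h₂ * l₁) (≤-trans linear-gap x≤h₂) ⟩
    h₂ * l₁ + h₂            ≡⟨ +-comm (h₂ * l₁) h₂ ⟩
    h₂ + h₂ * l₁            ≡⟨ sym (*-suc h₂ l₁) ⟩
    h₂ * suc l₁             ≤⟨ *-monoʳ-≤ h₂ l₁<l₂ ⟩
    h₂ * l₂                 ∎

  -- Equal low factors: a larger high factor adds at least l ≥ x₁.
  larger-high-factor : ∀ {h₁ h₂ l} → x₁ ≤ l → h₁ < h₂ → x₁ + h₁ * l ≤ h₂ * l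
  larger-high-factor {h₁} {h₂} {l} x₁≤l h₁<h₂ = begin
    x₁ + h₁ * l ≤⟨ +-monoˡ-≤ (h₁ * l) x₁≤l ⟩
    suc h₁ * l  ≤⟨ *-monoˡ-≤ l h₁<h₂ ⟩
    h₂ * l      ∎

  mixed-apart : ∀ {h₁ l₁ h₂ l₂} → Size true h₁ → Size false l₁ → Size true h₂ → Size false l₂ →
                h₁ * l₁ ≢ h₂ * l₂ → Apart x₁ (h₁ * l₁) (h₂ * l₂)
  mixed-apart {h₁} {l₁} {h₂} {l₂} (high x≤h₁ h₁≤) (low x₁≤l₁ l₁≤y) (high x≤h₂ h₂≤) (low _ l₂≤y) ≢
    with <-cmp l₁ l₂
  ... | tri< l₁<l₂ _ _ = inj₂ (larger-low-factor h₁≤ x≤h₂ l₁≤y l₁<l₂)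
  ... | tri> _ _ l₂<l₁ = inj₁ (larger-low-factor h₂≤ x≤h₁ l₂≤y l₂<l₁)
  ... | tri≈ _ refl _ with <-cmp h₁ h₂
  ...   | tri< h₁<h₂ _ _ = inj₂ (larger-high-factor x₁≤l₁ h₁<h₂)
  ...   | tri≈ _ refl _  = ⊥-elim (≢ refl)
  ...   | tri> _ _ h₂<h₁ = inj₁ (larger-high-factor x₁≤l₁ h₂<h₁)

  separate : ∀ {a o a′ o′ p q} → Shape a o p → Shape a′ o′ q →
             ¬ T (a ∧ a′) → T (o ∨ o′) → p ≢ q → Apart x₁ p q
  separate (high×high _)    (high×high _)    notAllHigh _ _ = ⊥-elim (notAllHigh tt)
  separate (low×low _)      (low×low _)      _ () _
  separate (high×high x²≤)  (high×low h l)   _ _ _ = inj₁ (above-x² (mixed-upper h l) x²≤)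
  separate (high×high x²≤)  (low×low ≤y²)    _ _ _ = inj₁ (above-x² (≤-trans ≤y² low×low≤mixed) x²≤)
  separate (high×low h l)   (high×high x²≤)  _ _ _ = inj₂ (above-x² (mixed-upper h l) x²≤)
  separate (high×low h l)   (low×low ≤y²)    _ _ _ = inj₁ (above-x ≤y² (mixed-lower h l))
  separate (low×low ≤y²)    (high×high x²≤)  _ _ _ = inj₂ (above-x² (≤-trans ≤y² low×low≤mixed) x²≤)
  separate (low×low ≤y²)    (high×low h l)   _ _ _ = inj₂ (above-x ≤y² (mixed-lower h l))
  separate (high×low h₁ l₁) (high×low h₂ l₂) _ _ ≢ = mixed-apart h₁ l₁ h₂ l₂ ≢

  products-apart : ∀ {b₁ b₂ b₃ b₄ c₁ c₂ c₃ c₄} →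
    Size b₁ c₁ → Size b₂ c₂ → Size b₃ c₃ → Size b₄ c₄ →
    ¬ T ((b₁ ∧ b₂) ∧ (b₃ ∧ b₄)) → T ((b₁ ∨ b₂) ∨ (b₃ ∨ b₄)) →
    c₁ * c₂ ≢ c₃ * c₄ → Apart x₁ (c₁ * c₂) (c₃ * c₄)
  products-apart s₁ s₂ s₃ s₄ = separate (shape s₁ s₂) (shape s₃ s₄)

≤-maxS : ∀ {a} S → a ∈ elems S → a ≤ maxS S
≤-maxS S a∈S = foldr-preservesᵒ (λ m n → [ m≤n⇒m≤n⊔o n , m≤n⇒m≤o⊔n m ]) (hd S) (tl S)
  (head-or-tail a∈S)
  where
  head-or-tail : ∀ {a} → a ∈ elems S → a ≤ hd S ⊎ Any.Any (a ≤_) (tl S)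
  head-or-tail (here a≡hd)  = inj₁ (≤-reflexive a≡hd)
  head-or-tail (there a∈tl) = inj₂ (Any.map ≤-reflexive a∈tl)

module Construction (x₁ : ℕ) (x₁-pos : 0 < x₁) (A : ℕ → NEFinSet) where
  X : ℕ → ℕ
  X = xs x₁ A

  M : ℕ → ℕ
  M k = maxS (A k)

  blockMax : ℕ → ℕ
  blockMax k = X k + M k

  earlierMax : ℕ → ℕ
  earlierMax zero    = 0
  earlierMax (suc k) = blockMax k

  -- The recursion for x_{k+1} is designed to give exactly these conditions;
  -- for the first block there are no earlier elements and they hold trivially.
  spacing : ∀ n → Spacing x₁ (X n) (M n) (earlierMax n)
  spacing zero = record
    { x₁-pos     = x₁-pos
    ; linear-gap = ≤-reflexive (trans (cong (_+_ x₁) (*-zeroʳ (M 0))) (+-identityʳ x₁))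
    ; square-gap = ≤-reflexive (+-identityʳ x₁)
    }
  spacing (suc k) = record
    { x₁-pos     = x₁-pos
    ; linear-gap = ≤-trans (+-monoˡ-≤ (m * y) (m≤m+n x₁ (m * m))) (m≤m+n _ (y * y))
    ; square-gap = +-monoˡ-≤ (y * y) (≤-trans (m≤m+n x₁ (m * m)) (m≤m+n _ (m * y)))
    }
    where
    m y : ℕ
    m = M (suc k)
    y = blockMax k

  x₁≤X : ∀ k → x₁ ≤ X k
  x₁≤X k = ≤-trans (m≤m+n x₁ _) (Spacing.square-gap (spacing k))

  -- Block maxima increase: blockMax k ≤ (blockMax k)² < X (k+1).
  blockMax-step : ∀ k → blockMax k ≤ blockMax (suc k)
  blockMax-step k = ≤-trans (n≤n*n (blockMax k)) (≤-trans (m≤n+m _ x₁)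
    (≤-trans (Spacing.square-gap (spacing (suc k))) (m≤m+n _ (M (suc k)))))

  blockMax-mono : ∀ {k m} → k ≤ m → blockMax k ≤ blockMax m
  blockMax-mono {m = zero}  z≤n = ≤-refl
  blockMax-mono {m = suc m} k≤1+m with m≤n⇒m<n∨m≡n k≤1+m
  ... | inj₁ (s≤s k≤m) = ≤-trans (blockMax-mono k≤m) (blockMax-step m)
  ... | inj₂ refl      = ≤-refl

  blockMax≤earlierMax : ∀ {k n} → k < n → blockMax k ≤ earlierMax n
  blockMax≤earlierMax {n = suc n} (s≤s k≤n) = blockMax-mono k≤n

  member-bounds : ∀ {k c} → InTranslate x₁ A k c → X k ≤ c × c ≤ blockMax k
  member-bounds {k} (a , a∈A , refl) = m≤m+n (X k) a , +-monoʳ-≤ (X k) (≤-maxS (A k) a∈A)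

  classify : ∀ {n k c} → k ≤ n → InTranslate x₁ A k c →
             SpacedBlocks.Size (spacing n) ⌊ k ≟ n ⌋ c
  classify {n} {k} k≤n c∈ with member-bounds c∈ | k ≟ n
  ... | X≤c , c≤max | yes refl = SpacedBlocks.high X≤c c≤max
  ... | X≤c , c≤max | no k≢n   = SpacedBlocks.low (≤-trans (x₁≤X k) X≤c)
                                   (≤-trans c≤max (blockMax≤earlierMax (≤∧≢⇒< k≤n k≢n)))

pair-attained : ∀ a b {n} → a ⊔ b ≡ n → T (⌊ a ≟ n ⌋ ∨ ⌊ b ≟ n ⌋)
pair-attained a b {n} a⊔b≡n with ⊔-sel a b
... | inj₁ a⊔b≡a = Equivalence.from (T-∨ {⌊ a ≟ n ⌋})
                     (inj₁ (fromWitness (trans (sym a⊔b≡a) a⊔b≡n)))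
... | inj₂ a⊔b≡b = Equivalence.from (T-∨ {⌊ a ≟ n ⌋})
                     (inj₂ (fromWitness (trans (sym a⊔b≡b) a⊔b≡n)))

all-equal : ∀ {k₁ k₂ k₃ k₄ n} → T ((⌊ k₁ ≟ n ⌋ ∧ ⌊ k₂ ≟ n ⌋) ∧ (⌊ k₃ ≟ n ⌋ ∧ ⌊ k₄ ≟ n ⌋)) →
            k₁ ≡ n × k₂ ≡ n × k₃ ≡ n × k₄ ≡ n
all-equal {k₁} {k₂} {k₃} {k₄} {n} all
  with Equivalence.to (T-∧ {⌊ k₁ ≟ n ⌋ ∧ ⌊ k₂ ≟ n ⌋}) all
... | t₁₂ , t₃₄ with Equivalence.to (T-∧ {⌊ k₁ ≟ n ⌋}) t₁₂ | Equivalence.to (T-∧ {⌊ k₃ ≟ n ⌋}) t₃₄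
... | t₁ , t₂ | t₃ , t₄ = toWitness t₁ , toWitness t₂ , toWitness t₃ , toWitness t₄

module Levels (k₁ k₂ k₃ k₄ : ℕ) where
  n : ℕ
  n = (k₁ ⊔ k₂) ⊔ (k₃ ⊔ k₄)

  k₁≤n : k₁ ≤ n
  k₁≤n = m≤n⇒m≤n⊔o (k₃ ⊔ k₄) (m≤m⊔n k₁ k₂)
  k₂≤n : k₂ ≤ n
  k₂≤n = m≤n⇒m≤n⊔o (k₃ ⊔ k₄) (m≤n⊔m k₁ k₂)
  k₃≤n : k₃ ≤ n
  k₃≤n = m≤n⇒m≤o⊔n (k₁ ⊔ k₂) (m≤m⊔n k₃ k₄)
  k₄≤n : k₄ ≤ n
  k₄≤n = m≤n⇒m≤o⊔n (k₁ ⊔ k₂) (m≤n⊔m k₃ k₄)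

  maximum-attained : T ((⌊ k₁ ≟ n ⌋ ∨ ⌊ k₂ ≟ n ⌋) ∨ (⌊ k₃ ≟ n ⌋ ∨ ⌊ k₄ ≟ n ⌋))
  maximum-attained with ⊔-sel (k₁ ⊔ k₂) (k₃ ⊔ k₄)
  ... | inj₁ n≡k₁⊔k₂ = Equivalence.from (T-∨ {⌊ k₁ ≟ n ⌋ ∨ ⌊ k₂ ≟ n ⌋})
                         (inj₁ (pair-attained k₁ k₂ (sym n≡k₁⊔k₂)))
  ... | inj₂ n≡k₃⊔k₄ = Equivalence.from (T-∨ {⌊ k₁ ≟ n ⌋ ∨ ⌊ k₂ ≟ n ⌋})
                         (inj₂ (pair-attained k₃ k₄ (sym n≡k₃⊔k₄)))

lemma2 : (x₁ : ℕ) → x₁ > 0 → (A : ℕ → NEFinSet) →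
    (c₁ c₂ c₃ c₄ : ℕ) →
    InUnion x₁ A c₁ → InUnion x₁ A c₂ → InUnion x₁ A c₃ → InUnion x₁ A c₄ →
    ¬ (∃ λ k → InTranslate x₁ A k c₁ × InTranslate x₁ A k c₂ × InTranslate x₁ A k c₃ × InTranslate x₁ A k c₄) →
    (+ (c₁ * c₂)) - (+ (c₃ * c₄)) ≢ + 0 →
    x₁ ≤ ∣ (+ (c₁ * c₂)) - (+ (c₃ * c₄)) ∣
lemma2 x₁ x₁>0 A c₁ c₂ c₃ c₄ (k₁ , c₁∈) (k₂ , c₂∈) (k₃ , c₃∈) (k₄ , c₄∈) notOneBlock d≢0 =
  apart⇒distance (products-apart
    (classify k₁≤n c₁∈) (classify k₂≤n c₂∈) (classify k₃≤n c₃∈) (classify k₄≤n c₄∈)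
    notAllInBlockN maximum-attained (difference≢0 (c₁ * c₂) (c₃ * c₄) d≢0))
  where
  open Construction x₁ x₁>0 A
  open Levels k₁ k₂ k₃ k₄
  open SpacedBlocks (spacing n)

  notAllInBlockN : ¬ T ((⌊ k₁ ≟ n ⌋ ∧ ⌊ k₂ ≟ n ⌋) ∧ (⌊ k₃ ≟ n ⌋ ∧ ⌊ k₄ ≟ n ⌋))
  notAllInBlockN all with all-equal all
  ... | k₁≡n , k₂≡n , k₃≡n , k₄≡n =
    notOneBlock (n , move k₁≡n c₁∈ , move k₂≡n c₂∈ , move k₃≡n c₃∈ , move k₄≡n c₄∈)
    where
    move : ∀ {k c} → k ≡ n → InTranslate x₁ A k c → InTranslate x₁ A n c
    move {c = c} k≡n = subst (λ k → InTranslate x₁ A k c) k≡n
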